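{- $\gamma_p(KN_{6k+1,2}) = 4k+2$ for all integers $k\ge 0$, and $\gamma_p(KN_{n,2}) = 4k$ for all integers $k\ge 1$ and $6k-4\le n\le 6k$.
   Context: For a graph $G=(V,E)$, a set $S\subseteq V$ is a perfect dominating set if every vertex $v\in V\setminus S$ is adjacent to exactly one vertex of $S$. The perfect domination number $\gamma_p(G)$ is the minimum cardinality of a perfect dominating set of $G$. The knights graph $KN_{n,m}$ has vertex set $\{(i,j): 1\le i\le n,\ 1\le j\le m\}$ (column $i$, row $j$ of a chessboard with $n$ columns and $m$ rows), and $(a,b)$ is adjacent to $(c,d)$ iff $\{|a-c|,|b-d|\}=\{1,2\}$. -}

module Defs where

open import Data.Nat using (ℕ; _≡ᵇ_; ∣_-_∣; _+_; _≤_)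
open import Data.Bool using (Bool; true; false; _∧_; _∨_; if_then_else_)
open import Data.Fin using (Fin; toℕ)
open import Data.Product using (_×_; _,_; Σ)
open import Data.List using (List; allFin; concatMap; map; length; filter)
open import Relation.Binary.PropositionalEquality using (_≡_)
open import Relation.Nullary.Decidable using (Dec)
open import Data.Bool using (T)
open import Relation.Nullary.Decidable using (yes; no)
open import Data.Bool.Properties using (T?)

-- Vertices of the knights graph KN_{n,m}: (column, row), 0-indexed.
Vertex : ℕ → ℕ → Set
Vertex n m = Fin n × Fin m

vertices : (n m : ℕ) → List (Vertex n m)
vertices n m = concatMap (λ i → map (λ j → (i , j)) (allFin m)) (allFin n)

adj : {n m : ℕ} → Vertex n m → Vertex n m → Bool
adj (a , b) (c , d) =
  let x = ∣ toℕ a - toℕ c ∣ ; y = ∣ toℕ b - toℕ d ∣ in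
  ((x ≡ᵇ 1) ∧ (y ≡ᵇ 2)) ∨ ((x ≡ᵇ 2) ∧ (y ≡ᵇ 1))

VSet : ℕ → ℕ → Set
VSet n m = Vertex n m → Bool

card : {n m : ℕ} → VSet n m → ℕ
card {n} {m} S = length (filter (λ v → T? (S v)) (vertices n m))

nbrsIn : {n m : ℕ} → VSet n m → Vertex n m → ℕ
nbrsIn {n} {m} S v = length (filter (λ u → T? (S u ∧ adj u v)) (vertices n m))

IsPerfectDominating : {n m : ℕ} → VSet n m → Set
IsPerfectDominating S = ∀ v → S v ≡ false → nbrsIn S v ≡ 1

PerfectDominationNumber : (n m g : ℕ) → Set
PerfectDominationNumber n m g =
  Σ (VSet n m) (λ S → IsPerfectDominating S × card S ≡ g)
  × (∀ (S : VSet n m) → IsPerfectDominating S → g ≤ card S)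

module Submission where

-- A knight on two rows always moves two columns and changes row, so KN_{n,2} is the disjoint
-- union of four paths, starting in column 0 or 1 and in either row, with ⌈n/2⌉, ⌈n/2⌉, ⌊n/2⌋
-- and ⌊n/2⌋ vertices.  Every vertex of a path is in a perfect dominating set S or has a
-- neighbour in it, so of any vertex and its (at most two) path neighbours one lies in S;
-- hence S contains at least ⌈L/3⌉ vertices of a path with L vertices.  For n = 6k+1 this
-- gives 2(k+1) + 2k, and for 6k-4 ≤ n ≤ 6k it gives 4k.
-- Conversely, take both squares of the columns congruent to 0, 3 (mod 6) when n = 6k+1, and
-- to 0, 1 or 1, 2 or 2, 3 (mod 6) according to n mod 6 otherwise: every unselected column
-- then has exactly one selected column at distance two, which by periodicity is a finite check.

open import Defs
open import Data.Bool using (Bool; true; false; _∧_; _∨_; T)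
open import Data.Bool.Properties using (T?; ∧-zeroʳ; ∧-identityʳ; ∧-comm; ∧-conicalˡ; ∧-conicalʳ)
import Data.Bool.Properties as Bool
open import Data.Fin using (Fin; suc; toℕ; fromℕ<; #_)
open import Data.Fin.Patterns using (0F; 1F)
open import Data.Fin.Properties using (toℕ<n; toℕ-fromℕ<; fromℕ<-toℕ; all?)
open import Data.List using (_∷_; length; filter; map; concatMap; allFin; tabulate)
open import Data.Nat using (ℕ; zero; suc; _+_; _*_; _∸_; _≤_; _<_; _≡ᵇ_; ∣_-_∣; ⌊_/2⌋; ⌈_/2⌉; z≤n; s≤s)
open import Data.Nat.Properties
open import Algebra.Properties.CommutativeSemigroup +-commutativeSemigroup using (interchange)
open import Data.Nat.Tactic.RingSolver using (solve-∀)
open import Data.Product using (_×_; _,_; Σ; ∃)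
open import Data.Sum using (_⊎_; inj₁; inj₂)
import Data.Sum as Sum
open import Data.Unit using (tt)
open import Relation.Nullary using (Dec; yes; no; contradiction)
open import Relation.Nullary.Decidable using (_→-dec_; From-yes; from-yes)
open import Relation.Binary.PropositionalEquality

∑ : ℕ → (ℕ → ℕ) → ℕ
∑ zero    f = 0
∑ (suc n) f = f 0 + ∑ n (λ t → f (suc t))

syntax ∑ n (λ t → e) = ∑[ t < n ] e

∑-cong : ∀ n {f g : ℕ → ℕ} → (∀ t → f t ≡ g t) → ∑ n f ≡ ∑ n g
∑-cong zero    eq = refl
∑-cong (suc n) eq = cong₂ _+_ (eq 0) (∑-cong n (λ t → eq (suc t)))

∑-distrib-+ : ∀ n (f g : ℕ → ℕ) → ∑[ t < n ] (f t + g t) ≡ ∑ n f + ∑ n g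
∑-distrib-+ zero    f g = refl
∑-distrib-+ (suc n) f g = trans (cong (f 0 + g 0 +_) (∑-distrib-+ n _ _)) (interchange (f 0) (g 0) _ _)

∑-mono-≤ : ∀ n {f g : ℕ → ℕ} → (∀ t → t < n → f t ≤ g t) → ∑ n f ≤ ∑ n g
∑-mono-≤ zero    le = z≤n
∑-mono-≤ (suc n) le = +-mono-≤ (le 0 (s≤s z≤n)) (∑-mono-≤ n (λ t t<n → le (suc t) (s≤s t<n)))

∑-const-1 : ∀ n → ∑[ t < n ] 1 ≡ n
∑-const-1 zero    = refl
∑-const-1 (suc n) = cong suc (∑-const-1 n)

∑-zeros : ∀ n → ∑[ t < n ] 0 ≡ 0
∑-zeros zero    = refl
∑-zeros (suc n) = ∑-zeros n

∑-split : ∀ m k (f : ℕ → ℕ) → ∑ (m + k) f ≡ ∑ m f + ∑[ t < k ] f (m + t)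
∑-split zero    k f = refl
∑-split (suc m) k f = trans (cong (f 0 +_) (∑-split m k _)) (sym (+-assoc (f 0) _ _))

∑-snoc : ∀ n (f : ℕ → ℕ) → ∑ (suc n) f ≡ ∑ n f + f n
∑-snoc zero    f = +-identityʳ (f 0)
∑-snoc (suc n) f = trans (cong (f 0 +_) (∑-snoc n _)) (sym (+-assoc (f 0) _ _))

p*[1+k]+e≡p+[p*k+e] : ∀ p k e → p * suc k + e ≡ p + (p * k + e)
p*[1+k]+e≡p+[p*k+e] p k e = trans (cong (_+ e) (*-suc p k)) (+-assoc p (p * k) e)

periodic : ∀ {A : Set} p (f : ℕ → A) → (∀ j → f (p + j) ≡ f j) → ∀ k e → f (p * k + e) ≡ f e
periodic p f per zero    e = cong f (cong (_+ e) (*-zeroʳ p))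
periodic p f per (suc k) e =
  trans (cong f (p*[1+k]+e≡p+[p*k+e] p k e)) (trans (per (p * k + e)) (periodic p f per k e))

∑-periodic : ∀ p (f : ℕ → ℕ) → (∀ j → f (p + j) ≡ f j) → ∀ k e → ∑ (p * k + e) f ≡ k * ∑ p f + ∑ e f
∑-periodic p f per zero    e = cong (λ m → ∑ (m + e) f) (*-zeroʳ p)
∑-periodic p f per (suc k) e = begin
  ∑ (p * suc k + e) f                    ≡⟨ cong (λ m → ∑ m f) (p*[1+k]+e≡p+[p*k+e] p k e) ⟩
  ∑ (p + (p * k + e)) f                  ≡⟨ ∑-split p (p * k + e) f ⟩
  ∑ p f + ∑[ t < p * k + e ] f (p + t)   ≡⟨ cong (∑ p f +_) (∑-cong (p * k + e) per) ⟩
  ∑ p f + ∑ (p * k + e) f                ≡⟨ cong (∑ p f +_) (∑-periodic p f per k e) ⟩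
  ∑ p f + (k * ∑ p f + ∑ e f)            ≡⟨ sym (+-assoc (∑ p f) _ _) ⟩
  suc k * ∑ p f + ∑ e f                  ∎
  where open ≡-Reasoning

∑-parity : ∀ n (f : ℕ → ℕ) → ∑ n f ≡ ∑[ t < ⌈ n /2⌉ ] f (t + t) + ∑[ t < ⌊ n /2⌋ ] f (suc (t + t))
∑-parity zero          f = refl
∑-parity (suc zero)    f = sym (+-identityʳ (f 0 + 0))
∑-parity (suc (suc n)) f = begin
  f 0 + (f 1 + ∑[ t < n ] f (2 + t))
    ≡⟨ cong (λ x → f 0 + (f 1 + x)) (∑-parity n (λ t → f (2 + t))) ⟩
  f 0 + (f 1 + (∑[ t < ⌈ n /2⌉ ] f (2 + (t + t)) + ∑[ t < ⌊ n /2⌋ ] f (3 + (t + t))))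
    ≡⟨ trans (sym (+-assoc (f 0) (f 1) _)) (interchange (f 0) (f 1) _ _) ⟩
  (f 0 + ∑[ t < ⌈ n /2⌉ ] f (2 + (t + t))) + (f 1 + ∑[ t < ⌊ n /2⌋ ] f (3 + (t + t)))
    ≡⟨ cong₂ (λ x y → (f 0 + x) + (f 1 + y)) (∑-cong ⌈ n /2⌉ (shift f)) (∑-cong ⌊ n /2⌋ (shift (λ j → f (suc j)))) ⟩
  (f 0 + ∑[ t < ⌈ n /2⌉ ] f (suc t + suc t)) + (f 1 + ∑[ t < ⌊ n /2⌋ ] f (suc (suc t + suc t))) ∎
  where
  open ≡-Reasoning
  shift : ∀ (g : ℕ → ℕ) t → g (2 + (t + t)) ≡ g (suc t + suc t)
  shift g t = cong (λ x → g (suc x)) (sym (+-suc t t))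

m<⌊n/2⌋⇒1+[m+m]<n : ∀ {n} m → m < ⌊ n /2⌋ → suc (m + m) < n
m<⌊n/2⌋⇒1+[m+m]<n {suc (suc n)} zero    _          = s≤s (s≤s z≤n)
m<⌊n/2⌋⇒1+[m+m]<n {suc (suc n)} (suc m) (s≤s m<n) =
  s≤s (s≤s (subst (λ x → suc x ≤ n) (sym (+-suc m m)) (m<⌊n/2⌋⇒1+[m+m]<n m m<n)))

n≤1+[⌊n/2⌋+⌊n/2⌋] : ∀ n → n ≤ suc (⌊ n /2⌋ + ⌊ n /2⌋)
n≤1+[⌊n/2⌋+⌊n/2⌋] zero          = z≤n
n≤1+[⌊n/2⌋+⌊n/2⌋] (suc zero)    = s≤s z≤n
n≤1+[⌊n/2⌋+⌊n/2⌋] (suc (suc n)) =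
  s≤s (subst (λ x → suc n ≤ suc x) (sym (+-suc ⌊ n /2⌋ ⌊ n /2⌋)) (s≤s (n≤1+[⌊n/2⌋+⌊n/2⌋] n)))

m<⌈n/2⌉⇒m+m<n : ∀ {n} m → m < ⌈ n /2⌉ → m + m < n
m<⌈n/2⌉⇒m+m<n m m<⌈n/2⌉ = ≤-pred (m<⌊n/2⌋⇒1+[m+m]<n m m<⌈n/2⌉)

n≤⌈n/2⌉+⌈n/2⌉ : ∀ n → n ≤ ⌈ n /2⌉ + ⌈ n /2⌉
n≤⌈n/2⌉+⌈n/2⌉ n = ≤-pred (n≤1+[⌊n/2⌋+⌊n/2⌋] (suc n))

∣m-n∣≡d⇒ : ∀ m n {d} → ∣ m - n ∣ ≡ d → m ≡ n + d ⊎ n ≡ m + d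
∣m-n∣≡d⇒ zero    n       eq = inj₂ eq
∣m-n∣≡d⇒ (suc m) zero    eq = inj₁ eq
∣m-n∣≡d⇒ (suc m) (suc n) eq = Sum.map (cong suc) (cong suc) (∣m-n∣≡d⇒ m n eq)

-- The knight graph on two rows

bit : Bool → ℕ
bit true  = 1
bit false = 0

length-filter-∷ : ∀ {A : Set} (F : A → Bool) x xs →
  length (filter (λ u → T? (F u)) (x ∷ xs)) ≡ bit (F x) + length (filter (λ u → T? (F u)) xs)
length-filter-∷ F x xs with F x
... | true  = refl
... | false = refl

card-by-columns : ∀ {n} (F : VSet n 2) (g : ℕ → ℕ) →
  (∀ a → bit (F (a , 0F)) + bit (F (a , 1F)) ≡ g (toℕ a)) → card F ≡ ∑ n g
card-by-columns {n} F = count (λ a → a)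
  where
  count : ∀ {m} (h : Fin m → Fin n) (g : ℕ → ℕ) →
    (∀ a → bit (F (h a , 0F)) + bit (F (h a , 1F)) ≡ g (toℕ a)) →
    length (filter (λ u → T? (F u)) (concatMap (λ i → map (λ j → (i , j)) (allFin 2)) (tabulate h))) ≡ ∑ m g
  count {zero}  h g column = refl
  count {suc m} h g column =
    trans (length-filter-∷ F _ _)
    (trans (cong (bit (F (h 0F , 0F)) +_) (length-filter-∷ F _ _))
    (trans (sym (+-assoc (bit (F (h 0F , 0F))) _ _))
           (cong₂ _+_ (column 0F) (count (λ a → h (suc a)) (λ t → g (suc t)) (λ a → column (suc a))))))

filter-witness : ∀ {A : Set} (F : A → Bool) xs → 0 < length (filter (λ u → T? (F u)) xs) →
  ∃ λ x → F x ≡ true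
filter-witness F (x ∷ xs) nonempty with F x in Fx
... | true  = x , Fx
... | false = filter-witness F xs nonempty

perfect⇒neighbour : ∀ {n m} {S : VSet n m} → IsPerfectDominating S → ∀ {v} → S v ≡ false →
  ∃ λ u → S u ≡ true × adj u v ≡ true
perfect⇒neighbour {n} {m} {S} pd {v} v∉S
  with u , u∈S∧u~v ← filter-witness (λ u → S u ∧ adj u v) (vertices n m) (≤-reflexive (sym (pd v v∉S)))
  = u , ∧-conicalˡ _ _ u∈S∧u~v , ∧-conicalʳ _ _ u∈S∧u~v

opposite : Fin 2 → Fin 2
opposite 0F = 1F
opposite 1F = 0F

opposite-involutive : ∀ r → opposite (opposite r) ≡ r
opposite-involutive 0F = refl
opposite-involutive 1F = refl

adj-twoRows : ∀ {n} (c a : Fin n) (b r : Fin 2) →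
  adj (c , b) (a , r) ≡ (∣ toℕ b - toℕ r ∣ ≡ᵇ 1) ∧ (∣ toℕ c - toℕ a ∣ ≡ᵇ 2)
adj-twoRows c a 0F 0F = cong₂ _∨_ (∧-zeroʳ (∣ toℕ c - toℕ a ∣ ≡ᵇ 1)) (∧-zeroʳ (∣ toℕ c - toℕ a ∣ ≡ᵇ 2))
adj-twoRows c a 0F 1F = cong₂ _∨_ (∧-zeroʳ (∣ toℕ c - toℕ a ∣ ≡ᵇ 1)) (∧-identityʳ (∣ toℕ c - toℕ a ∣ ≡ᵇ 2))
adj-twoRows c a 1F 0F = cong₂ _∨_ (∧-zeroʳ (∣ toℕ c - toℕ a ∣ ≡ᵇ 1)) (∧-identityʳ (∣ toℕ c - toℕ a ∣ ≡ᵇ 2))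
adj-twoRows c a 1F 1F = cong₂ _∨_ (∧-zeroʳ (∣ toℕ c - toℕ a ∣ ≡ᵇ 1)) (∧-zeroʳ (∣ toℕ c - toℕ a ∣ ≡ᵇ 2))

adj⇒opposite×distance2 : ∀ {n} (c a : Fin n) (b r : Fin 2) → adj (c , b) (a , r) ≡ true →
  b ≡ opposite r × ∣ toℕ c - toℕ a ∣ ≡ 2
adj⇒opposite×distance2 c a 0F 0F e = contradiction (trans (sym (adj-twoRows c a 0F 0F)) e) λ ()
adj⇒opposite×distance2 c a 0F 1F e = refl , ≡ᵇ⇒≡ _ 2 (subst T (sym (trans (sym (adj-twoRows c a 0F 1F)) e)) tt)
adj⇒opposite×distance2 c a 1F 0F e = refl , ≡ᵇ⇒≡ _ 2 (subst T (sym (trans (sym (adj-twoRows c a 1F 0F)) e)) tt)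
adj⇒opposite×distance2 c a 1F 1F e = contradiction (trans (sym (adj-twoRows c a 1F 1F)) e) λ ()

perfect⇒neighbour-twoRows : ∀ {n} {S : VSet n 2} → IsPerfectDominating S → ∀ {a r} → S (a , r) ≡ false →
  ∃ λ c → S (c , opposite r) ≡ true × (toℕ c ≡ toℕ a + 2 ⊎ toℕ a ≡ toℕ c + 2)
perfect⇒neighbour-twoRows pd {a} {r} v∉S
  with (c , b) , u∈S , u~v ← perfect⇒neighbour pd v∉S
  with refl , distance ← adj⇒opposite×distance2 c a b r u~v
  = c , u∈S , ∣m-n∣≡d⇒ (toℕ c) (toℕ a) distance

-- Lower bound: the four knight paths

cell : ∀ {n} → VSet n 2 → Fin 2 → ℕ → ℕ
cell {n} S r j with j <? n
... | yes j<n = bit (S (fromℕ< j<n , r))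
... | no  _   = 0

cell-toℕ : ∀ {n} (S : VSet n 2) r (a : Fin n) → cell S r (toℕ a) ≡ bit (S (a , r))
cell-toℕ {n} S r a with toℕ a <? n
... | yes a<n = cong (λ c → bit (S (c , r))) (fromℕ<-toℕ a a<n)
... | no  a≮n = contradiction (toℕ<n a) a≮n

cell-≥ : ∀ {n} (S : VSet n 2) r {j} → n ≤ j → cell S r j ≡ 0
cell-≥ {n} S r {j} n≤j with j <? n
... | yes j<n = contradiction n≤j (<⇒≱ j<n)
... | no  _   = refl

cell-one : ∀ {n} {S : VSet n 2} {r c j} → toℕ c ≡ j → S (c , r) ≡ true → cell S r j ≡ 1
cell-one {S = S} {r} {c} refl c∈S = trans (cell-toℕ S r c) (cong bit c∈S)

alternate : Fin 2 → ℕ → Fin 2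
alternate r zero    = r
alternate r (suc t) = opposite (alternate r t)

-- The knight path (q, r), (q + 2, r′), (q + 4, r), …; for q ∈ {0, 1} and both rows r these
-- four paths partition the board.
path : ∀ {n} → VSet n 2 → ℕ → Fin 2 → ℕ → ℕ
path S q r t = cell S (alternate r t) (q + (t + t))

previous : (ℕ → ℕ) → ℕ → ℕ
previous P zero    = 0
previous P (suc t) = P t

path-column-+2 : ∀ q t → q + (t + t) + 2 ≡ q + (suc t + suc t)
path-column-+2 = solve-∀

path-covered : ∀ {n} {S : VSet n 2} {q} → IsPerfectDominating S → q ≤ 1 → ∀ r t → q + (t + t) < n →
  previous (path S q r) t ≡ 1 ⊎ path S q r t ≡ 1 ⊎ path S q r (suc t) ≡ 1
path-covered {n} {S} {q} pd q≤1 r t inside with S (fromℕ< inside , alternate r t) in v∈S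
... | true = inj₂ (inj₁ (cell-one (toℕ-fromℕ< inside) v∈S))
... | false with perfect⇒neighbour-twoRows pd v∈S
...   | c , c∈S , inj₁ forward =
  inj₂ (inj₂ (cell-one (trans forward (trans (cong (_+ 2) (toℕ-fromℕ< inside)) (path-column-+2 q t))) c∈S))
...   | c , c∈S , inj₂ backward = inj₁ (from-previous t inside backward c∈S)
  where
  from-previous : ∀ t (inside : q + (t + t) < n) → toℕ (fromℕ< inside) ≡ toℕ c + 2 →
    S (c , opposite (alternate r t)) ≡ true → previous (path S q r) t ≡ 1
  from-previous zero    inside eq _ =
    contradiction (≤-trans (m≤n+m 2 (toℕ c)) (≤-reflexive (trans (sym eq) (trans (toℕ-fromℕ< inside) (+-identityʳ q)))))
                  (<⇒≱ (s≤s q≤1))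
  from-previous (suc s) inside eq c∈S =
    cell-one (+-cancelʳ-≡ 2 (toℕ c) (q + (s + s)) (trans (sym eq) (trans (toℕ-fromℕ< inside) (sym (path-column-+2 q s)))))
             (subst (λ b → S (c , b) ≡ true) (opposite-involutive (alternate r s)) c∈S)

covering-bound : ∀ (P : ℕ → ℕ) L → P L ≡ 0 →
  (∀ t → t < L → previous P t ≡ 1 ⊎ P t ≡ 1 ⊎ P (suc t) ≡ 1) → L ≤ 3 * ∑ L P
covering-bound P L P[L]≡0 covered = begin
  L                                                ≡⟨ sym (∑-const-1 L) ⟩
  ∑[ t < L ] 1                                     ≤⟨ ∑-mono-≤ L (λ t t<L → one-of-three (covered t t<L)) ⟩
  ∑[ t < L ] (previous P t + P t + P (suc t))      ≡⟨ trans (∑-distrib-+ L _ _) (cong (_+ ∑[ t < L ] P (suc t)) (∑-distrib-+ L _ _)) ⟩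
  ∑ L (previous P) + ∑ L P + ∑[ t < L ] P (suc t)  ≤⟨ +-mono-≤ (+-monoˡ-≤ (∑ L P) (∑-previous L)) ∑-next ⟩
  ∑ L P + ∑ L P + ∑ L P                            ≡⟨ triple (∑ L P) ⟩
  3 * ∑ L P                                        ∎
  where
  open ≤-Reasoning
  one-of-three : ∀ {a b c} → a ≡ 1 ⊎ b ≡ 1 ⊎ c ≡ 1 → 1 ≤ a + b + c
  one-of-three {b = b} {c} (inj₁ refl)        = m≤m+n 1 (b + c)
  one-of-three {a} {c = c} (inj₂ (inj₁ refl)) = ≤-trans (m≤n+m 1 a) (m≤m+n (a + 1) c)
  one-of-three {a} {b} (inj₂ (inj₂ refl))     = m≤n+m 1 (a + b)
  ∑-previous : ∀ L → ∑ L (previous P) ≤ ∑ L P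
  ∑-previous zero    = z≤n
  ∑-previous (suc L) = ≤-trans (m≤m+n (∑ L P) (P L)) (≤-reflexive (sym (∑-snoc L P)))
  ∑-next : ∑[ t < L ] P (suc t) ≤ ∑ L P
  ∑-next = ≤-trans (m≤n+m _ (P 0)) (≤-reflexive (trans (∑-snoc L P) (trans (cong (∑ L P +_) P[L]≡0) (+-identityʳ _))))
  triple : ∀ x → x + x + x ≡ 3 * x
  triple = solve-∀

path-bound : ∀ {n} {S : VSet n 2} {q L} → IsPerfectDominating S → q ≤ 1 →
  (∀ t → t < L → q + (t + t) < n) → n ≤ q + (L + L) → ∀ r → L ≤ 3 * ∑ L (path S q r)
path-bound {S = S} {q} {L} pd q≤1 inside beyond r =
  covering-bound (path S q r) L (cell-≥ S (alternate r L) beyond)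
                 (λ t t<L → path-covered pd q≤1 r t (inside t t<L))

card-as-paths : ∀ {n} (S : VSet n 2) → card S ≡
  (∑ ⌈ n /2⌉ (path S 0 0F) + ∑ ⌈ n /2⌉ (path S 0 1F)) + (∑ ⌊ n /2⌋ (path S 1 0F) + ∑ ⌊ n /2⌋ (path S 1 1F))
card-as-paths {n} S = begin
  card S
    ≡⟨ card-by-columns S column (λ a → sym (cong₂ _+_ (cell-toℕ S 0F a) (cell-toℕ S 1F a))) ⟩
  ∑ n column
    ≡⟨ ∑-parity n column ⟩
  ∑[ t < ⌈ n /2⌉ ] column (t + t) + ∑[ t < ⌊ n /2⌋ ] column (suc (t + t))
    ≡⟨ cong₂ _+_ (column-paths 0 ⌈ n /2⌉) (column-paths 1 ⌊ n /2⌋) ⟩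
  (∑ ⌈ n /2⌉ (path S 0 0F) + ∑ ⌈ n /2⌉ (path S 0 1F)) + (∑ ⌊ n /2⌋ (path S 1 0F) + ∑ ⌊ n /2⌋ (path S 1 1F)) ∎
  where
  open ≡-Reasoning
  column : ℕ → ℕ
  column j = cell S 0F j + cell S 1F j
  column-rows : ∀ r j → column j ≡ cell S r j + cell S (opposite r) j
  column-rows 0F j = refl
  column-rows 1F j = +-comm (cell S 0F j) (cell S 1F j)
  alternate-opposite : ∀ r t → alternate (opposite r) t ≡ opposite (alternate r t)
  alternate-opposite r zero    = refl
  alternate-opposite r (suc t) = cong opposite (alternate-opposite r t)
  column-paths : ∀ q L → ∑[ t < L ] column (q + (t + t)) ≡ ∑ L (path S q 0F) + ∑ L (path S q 1F)
  column-paths q L = trans (∑-cong L on-path) (∑-distrib-+ L _ _)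
    where
    on-path : ∀ t → column (q + (t + t)) ≡ path S q 0F t + path S q 1F t
    on-path t = trans (column-rows (alternate 0F t) (q + (t + t)))
                      (cong (λ r → path S q 0F t + cell S r (q + (t + t))) (sym (alternate-opposite 0F t)))

-- a ≤ ⌈L/3⌉ ≤ s
3a≤L+2⇒L≤3s⇒a≤s : ∀ {a L s} → 3 * a ≤ 2 + L → L ≤ 3 * s → a ≤ s
3a≤L+2⇒L≤3s⇒a≤s {a} {L} {s} 3a≤2+L L≤3s = ≤-pred (*-cancelˡ-< 3 a (suc s) (begin-strict
  3 * a      ≤⟨ 3a≤2+L ⟩
  2 + L      ≤⟨ +-monoʳ-≤ 2 L≤3s ⟩
  2 + 3 * s  <⟨ n<1+n _ ⟩
  3 + 3 * s  ≡⟨ sym (*-suc 3 s) ⟩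
  3 * suc s  ∎))
  where open ≤-Reasoning

-- The hypotheses say a ≤ ⌈⌈n/2⌉/3⌉ and b ≤ ⌈⌊n/2⌋/3⌉.
card-lower-bound : ∀ {n} {S : VSet n 2} {a b} → IsPerfectDominating S →
  3 * a ≤ 2 + ⌈ n /2⌉ → 3 * b ≤ 2 + ⌊ n /2⌋ → (a + a) + (b + b) ≤ card S
card-lower-bound {n} {S} {a} {b} pd 3a≤ 3b≤ =
  subst ((a + a) + (b + b) ≤_) (sym (card-as-paths S))
        (+-mono-≤ (+-mono-≤ (even-path 0F) (even-path 1F)) (+-mono-≤ (odd-path 0F) (odd-path 1F)))
  where
  even-path : ∀ r → a ≤ ∑ ⌈ n /2⌉ (path S 0 r)
  even-path r = 3a≤L+2⇒L≤3s⇒a≤s 3a≤ (path-bound pd z≤n m<⌈n/2⌉⇒m+m<n (n≤⌈n/2⌉+⌈n/2⌉ n) r)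
  odd-path : ∀ r → b ≤ ∑ ⌊ n /2⌋ (path S 1 r)
  odd-path r = 3a≤L+2⇒L≤3s⇒a≤s 3b≤ (path-bound pd ≤-refl m<⌊n/2⌋⇒1+[m+m]<n (n≤1+[⌊n/2⌋+⌊n/2⌋] n) r)

-- Upper bound: periodic selections of whole columns

columns : ∀ {n} → (ℕ → Bool) → VSet n 2
columns sel (a , _) = sel (toℕ a)

card-columns : ∀ {n} (sel : ℕ → Bool) → card (columns {n} sel) ≡ ∑[ j < n ] (bit (sel j) + bit (sel j))
card-columns {n} sel = card-by-columns (columns {n} sel) _ (λ a → refl)

nbrsIn-columns : ∀ {n} (sel : ℕ → Bool) (a : Fin n) r →
  nbrsIn (columns sel) (a , r) ≡ ∑[ j < n ] bit ((∣ j - toℕ a ∣ ≡ᵇ 2) ∧ sel j)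
nbrsIn-columns sel a r = card-by-columns _ _ (λ c → in-column c r)
  where
  in-column : ∀ c r → bit (sel (toℕ c) ∧ adj (c , 0F) (a , r)) + bit (sel (toℕ c) ∧ adj (c , 1F) (a , r))
                    ≡ bit ((∣ toℕ c - toℕ a ∣ ≡ᵇ 2) ∧ sel (toℕ c))
  in-column c 0F rewrite adj-twoRows c a 0F 0F | adj-twoRows c a 1F 0F =
    cong₂ _+_ (cong bit (∧-zeroʳ (sel (toℕ c)))) (cong bit (∧-comm (sel (toℕ c)) _))
  in-column c 1F rewrite adj-twoRows c a 0F 1F | adj-twoRows c a 1F 1F =
    trans (cong₂ _+_ (cong bit (∧-comm (sel (toℕ c)) _)) (cong bit (∧-zeroʳ (sel (toℕ c))))) (+-identityʳ _)

selectedTwoApart : (ℕ → Bool) → ℕ → ℕ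
selectedTwoApart sel zero          = bit (sel 2)
selectedTwoApart sel (suc zero)    = bit (sel 3)
selectedTwoApart sel (suc (suc i)) = bit (sel i) + bit (sel (4 + i))

∑-twoApart : ∀ (sel : ℕ → Bool) i m → i + 2 < m →
  ∑[ j < m ] bit ((∣ j - i ∣ ≡ᵇ 2) ∧ sel j) ≡ selectedTwoApart sel i
∑-twoApart sel zero          (suc (suc (suc m))) (s≤s (s≤s (s≤s _))) =
  trans (cong (bit (sel 2) +_) (∑-zeros m)) (+-identityʳ _)
∑-twoApart sel (suc zero)    (suc (suc (suc (suc m)))) (s≤s (s≤s (s≤s (s≤s _)))) =
  trans (cong (bit (sel 3) +_) (∑-zeros m)) (+-identityʳ _)
∑-twoApart sel (suc (suc zero))    (suc m) (s≤s lt) = cong (bit (sel 0) +_) (∑-twoApart _ 1 m lt)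
∑-twoApart sel (suc (suc (suc i))) (suc m) (s≤s lt) = ∑-twoApart _ (suc (suc i)) m lt

PerfectAt : (ℕ → Bool) → ℕ → Set
PerfectAt sel i = sel i ≡ false → selectedTwoApart sel i ≡ 1

perfectAt? : ∀ sel i → Dec (PerfectAt sel i)
perfectAt? sel i = (sel i Bool.≟ false) →-dec (selectedTwoApart sel i ≟ 1)

columns-perfect : ∀ {n} (sel : ℕ → Bool) → (∀ i → PerfectAt sel i) → sel n ≡ false → sel (suc n) ≡ false →
  IsPerfectDominating (columns {n} sel)
columns-perfect {n} sel perfect sel[n] sel[1+n] (a , r) a∉S = begin
  nbrsIn (columns sel) (a , r)          ≡⟨ nbrsIn-columns sel a r ⟩
  ∑ n count                             ≡⟨ sym (+-identityʳ _) ⟩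
  ∑ n count + 0                         ≡⟨ cong (∑ n count +_) (sym beyond) ⟩
  ∑ n count + ∑[ t < 2 ] count (n + t) ≡⟨ sym (∑-split n 2 count) ⟩
  ∑ (n + 2) count                       ≡⟨ ∑-twoApart sel (toℕ a) (n + 2) (+-monoˡ-< 2 (toℕ<n a)) ⟩
  selectedTwoApart sel (toℕ a)          ≡⟨ perfect (toℕ a) a∉S ⟩
  1                                     ∎
  where
  open ≡-Reasoning
  count : ℕ → ℕ
  count j = bit ((∣ j - toℕ a ∣ ≡ᵇ 2) ∧ sel j)
  unselected : ∀ {j} → sel j ≡ false → count j ≡ 0
  unselected {j} e = cong bit (trans (cong ((∣ j - toℕ a ∣ ≡ᵇ 2) ∧_) e) (∧-zeroʳ _))
  beyond : ∑[ t < 2 ] count (n + t) ≡ 0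
  beyond = cong₂ _+_ (unselected (trans (cong sel (+-identityʳ n)) sel[n]))
                     (cong (_+ 0) (unselected (trans (cong sel (+-comm n 1)) sel[1+n])))

perfectAt-+6 : ∀ (sel : ℕ → Bool) → (∀ j → sel (6 + j) ≡ sel j) → ∀ i → PerfectAt sel (2 + i) → PerfectAt sel (8 + i)
perfectAt-+6 sel per i perfect rewrite per (2 + i) | per i | per (4 + i) = perfect

-- For i ≥ 2, PerfectAt sel i only involves sel at i - 2, i and i + 2, so it is 6-periodic from 2 on.
perfectAt-periodic : ∀ (sel : ℕ → Bool) → (∀ j → sel (6 + j) ≡ sel j) →
  (∀ (i : Fin 8) → PerfectAt sel (toℕ i)) → ∀ i → PerfectAt sel i
perfectAt-periodic sel per small 0 = small (# 0)
perfectAt-periodic sel per small 1 = small (# 1)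
perfectAt-periodic sel per small 2 = small (# 2)
perfectAt-periodic sel per small 3 = small (# 3)
perfectAt-periodic sel per small 4 = small (# 4)
perfectAt-periodic sel per small 5 = small (# 5)
perfectAt-periodic sel per small 6 = small (# 6)
perfectAt-periodic sel per small 7 = small (# 7)
perfectAt-periodic sel per small (suc (suc (suc (suc (suc (suc (suc (suc i)))))))) =
  perfectAt-+6 sel per i (perfectAt-periodic sel per small (suc (suc i)))

PerfectDominatingOfSize : ℕ → ℕ → Set
PerfectDominatingOfSize n g = Σ (VSet n 2) λ S → IsPerfectDominating S × card S ≡ g

resize : ∀ {n g h} → g ≡ h → PerfectDominatingOfSize n g → PerfectDominatingOfSize n h
resize refl D = D

dominating-periodic : ∀ (sel : ℕ → Bool) → (∀ j → sel (6 + j) ≡ sel j) → (∀ (i : Fin 8) → PerfectAt sel (toℕ i)) →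
  ∀ k e → sel e ≡ false → sel (suc e) ≡ false →
  PerfectDominatingOfSize (6 * k + e) (k * ∑[ j < 6 ] (bit (sel j) + bit (sel j)) + ∑[ j < e ] (bit (sel j) + bit (sel j)))
dominating-periodic sel per small k e sel[e] sel[1+e] =
  columns {6 * k + e} sel ,
  columns-perfect sel (perfectAt-periodic sel per small)
    (trans (periodic 6 sel per k e) sel[e])
    (trans (cong sel (sym (+-suc (6 * k) e))) (trans (periodic 6 sel per k (suc e)) sel[1+e])) ,
  trans (card-columns {6 * k + e} sel) (∑-periodic 6 _ (λ j → cong (λ b → bit b + bit b) (per j)) k e)

cyclic : Bool → Bool → Bool → Bool → Bool → Bool → ℕ → Bool
cyclic b₀ b₁ b₂ b₃ b₄ b₅ 0 = b₀
cyclic b₀ b₁ b₂ b₃ b₄ b₅ 1 = b₁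
cyclic b₀ b₁ b₂ b₃ b₄ b₅ 2 = b₂
cyclic b₀ b₁ b₂ b₃ b₄ b₅ 3 = b₃
cyclic b₀ b₁ b₂ b₃ b₄ b₅ 4 = b₄
cyclic b₀ b₁ b₂ b₃ b₄ b₅ 5 = b₅
cyclic b₀ b₁ b₂ b₃ b₄ b₅ (suc (suc (suc (suc (suc (suc j)))))) = cyclic b₀ b₁ b₂ b₃ b₄ b₅ j

sel₀₃ sel₀₁ sel₁₂ sel₂₃ : ℕ → Bool
sel₀₃ = cyclic true  false false true  false false
sel₀₁ = cyclic true  true  false false false false
sel₁₂ = cyclic false true  true  false false false
sel₂₃ = cyclic false false true  true  false false

decide-perfectAt<8 : ∀ sel → From-yes (all? (λ (i : Fin 8) → perfectAt? sel (toℕ i)))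
decide-perfectAt<8 sel = from-yes (all? (λ (i : Fin 8) → perfectAt? sel (toℕ i)))

dominating-6k+1 : ∀ k → PerfectDominatingOfSize (6 * k + 1) (4 * k + 2)
dominating-6k+1 k = resize (cong (_+ 2) (*-comm k 4))
  (dominating-periodic sel₀₃ (λ _ → refl) (decide-perfectAt<8 sel₀₃) k 1 refl refl)

dominating-6k+e : ∀ k e → 2 ≤ e → e ≤ 6 → PerfectDominatingOfSize (6 * k + e) (k * 4 + 4)
dominating-6k+e k 2 _ _ = dominating-periodic sel₀₁ (λ _ → refl) (decide-perfectAt<8 sel₀₁) k 2 refl refl
dominating-6k+e k 3 _ _ = dominating-periodic sel₁₂ (λ _ → refl) (decide-perfectAt<8 sel₁₂) k 3 refl refl
dominating-6k+e k 4 _ _ = dominating-periodic sel₂₃ (λ _ → refl) (decide-perfectAt<8 sel₂₃) k 4 refl refl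
dominating-6k+e k 5 _ _ = dominating-periodic sel₂₃ (λ _ → refl) (decide-perfectAt<8 sel₂₃) k 5 refl refl
dominating-6k+e k 6 _ _ = dominating-periodic sel₂₃ (λ _ → refl) (decide-perfectAt<8 sel₂₃) k 6 refl refl
dominating-6k+e k 1 (s≤s ()) _
dominating-6k+e k (suc (suc (suc (suc (suc (suc (suc e))))))) _ (s≤s (s≤s (s≤s (s≤s (s≤s (s≤s ()))))))

dominating-range : ∀ k n → 2 + 6 * k ≤ n → n ≤ 6 + 6 * k → PerfectDominatingOfSize n (4 * suc k)
dominating-range k n lo hi =
  subst (λ m → PerfectDominatingOfSize m (4 * suc k)) (m+[n∸m]≡n (≤-trans (m≤n+m (6 * k) 2) lo))
        (resize (count k) (dominating-6k+e k (n ∸ 6 * k) 2≤e e≤6))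
  where
  count : ∀ k → k * 4 + 4 ≡ 4 * suc k
  count = solve-∀
  2≤e : 2 ≤ n ∸ 6 * k
  2≤e = subst (_≤ n ∸ 6 * k) (m+n∸n≡m 2 (6 * k)) (∸-monoˡ-≤ (6 * k) lo)
  e≤6 : n ∸ 6 * k ≤ 6
  e≤6 = subst (n ∸ 6 * k ≤_) (m+n∸n≡m 6 (6 * k)) (∸-monoˡ-≤ (6 * k) hi)

lower-6k+1 : ∀ k {S : VSet (6 * k + 1) 2} → IsPerfectDominating S → 4 * k + 2 ≤ card S
lower-6k+1 k {S} pd =
  subst (_≤ card S) (count k) (card-lower-bound {a = suc k} {b = k} pd 3[1+k]≤2+⌈n/2⌉ 3k≤2+⌊n/2⌋)
  where
  odd : ∀ k → 6 * k + 1 ≡ suc (3 * k + 3 * k)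
  odd = solve-∀
  3[1+k]≤2+⌈n/2⌉ : 3 * suc k ≤ 2 + ⌈ 6 * k + 1 /2⌉
  3[1+k]≤2+⌈n/2⌉ = ≤-reflexive (trans (*-suc 3 k)
    (cong (2 +_) (sym (trans (cong ⌈_/2⌉ (odd k)) (cong suc (sym (n≡⌊n+n/2⌋ (3 * k))))))))
  3k≤2+⌊n/2⌋ : 3 * k ≤ 2 + ⌊ 6 * k + 1 /2⌋
  3k≤2+⌊n/2⌋ = subst (λ m → 3 * k ≤ 2 + m) (trans (n≡⌈n+n/2⌉ (3 * k)) (cong ⌊_/2⌋ (sym (odd k)))) (m≤n+m (3 * k) 2)
  count : ∀ k → (suc k + suc k) + (k + k) ≡ 4 * k + 2
  count = solve-∀

lower-range : ∀ k n {S : VSet n 2} → 2 + 6 * k ≤ n → IsPerfectDominating S → 4 * suc k ≤ card S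
lower-range k n {S} lo pd = subst (_≤ card S) (count k)
  (card-lower-bound {a = suc k} {b = suc k} pd (≤-trans 3[1+k]≤2+⌊n/2⌋ (+-monoʳ-≤ 2 (⌊n/2⌋≤⌈n/2⌉ n))) 3[1+k]≤2+⌊n/2⌋)
  where
  even : ∀ k → 2 + 6 * k ≡ suc (3 * k) + suc (3 * k)
  even = solve-∀
  3[1+k]≤2+⌊n/2⌋ : 3 * suc k ≤ 2 + ⌊ n /2⌋
  3[1+k]≤2+⌊n/2⌋ = subst (_≤ 2 + ⌊ n /2⌋) (sym (*-suc 3 k))
    (+-monoʳ-≤ 2 (subst (_≤ ⌊ n /2⌋) (sym (n≡⌊n+n/2⌋ (suc (3 * k)))) (⌊n/2⌋-mono (subst (_≤ n) (even k) lo))))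
  count : ∀ k → (suc k + suc k) + (suc k + suc k) ≡ 4 * suc k
  count = solve-∀

proposition2p2 : (∀ (k : ℕ) → PerfectDominationNumber (6 * k + 1) 2 (4 * k + 2))
    × (∀ (k n : ℕ) → 1 ≤ k → 6 * k ∸ 4 ≤ n → n ≤ 6 * k → PerfectDominationNumber n 2 (4 * k))
proposition2p2 = (λ k → dominating-6k+1 k , λ S → lower-6k+1 k) , range
  where
  range : ∀ k n → 1 ≤ k → 6 * k ∸ 4 ≤ n → n ≤ 6 * k → PerfectDominationNumber n 2 (4 * k)
  range (suc k) n _ lo hi = dominating-range k n lo′ (subst (n ≤_) (*-suc 6 k) hi) , λ S → lower-range k n lo′
    where
    lo′ : 2 + 6 * k ≤ n
    lo′ = subst (_≤ n) (cong (_∸ 4) (*-suc 6 k)) lo
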